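{- Let $\mathbf v\in C^n$ and let $I,J,K$ be three pairwise disjoint nonempty subsets of $[n]$. (1) The unique circuit of the cube matroid $M(C^n)$ contained in $(C(\mathbf v;I,J)\cup C(\mathbf v;I,K))\setminus\{\mathbf v\}$ is $C({}_{ -J}\mathbf v;I,J\cup K)$. (2) The unique circuit of $M(C^n)$ contained in $(C(\mathbf v;I\cup J,K)\cup C(\mathbf v;I,J\cup K))\setminus\{\mathbf v\}$ is $C({}_{ -I}\mathbf v;J,I\cup K)$.
   Context: $C^n=\{ -1,1\}^n\subseteq\mathbb R^n$, $[n]=\{1,\dots,n\}$. $M(C^n)$ is the matroid on $C^n$ of affine dependencies over $\mathbb R$; a circuit is a minimal affinely dependent subset. For $\mathbf v\in C^n$ and $I\subseteq[n]$, ${}_{ -I}\mathbf v$ is the vertex obtained from $\mathbf v$ by negating the entries indexed by $I$. For disjoint nonempty $I,J\subseteq[n]$, $C(\mathbf v;I,J)=\{\mathbf v,{}_{ -I}\mathbf v,{}_{ -(I\cup J)}\mathbf v,{}_{ -J}\mathbf v\}$ (a rectangle of $C^n$). -}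

module Defs where

open import Data.Nat using (ℕ; zero; suc)
open import Data.Bool using (Bool; true; false; _xor_)
open import Data.Fin using (Fin)
open import Data.Fin.Subset using (Subset)
open import Data.Vec using (Vec; []; _∷_; zipWith; lookup)
open import Data.List using (List; []; _∷_; map; _++_; foldr)
open import Data.List.Membership.Propositional using (_∈_)
open import Data.Rational using (ℚ; 0ℚ; 1ℚ; -_; _+_; _*_)
open import Data.Product using (_×_; ∃)
open import Relation.Binary.PropositionalEquality using (_≡_; _≢_)
open import Relation.Nullary using (¬_)

-- A vertex of the cube C^n = {-1,1}^n, encoded as a bit vector:
-- bit false ↦ coordinate +1, bit true ↦ coordinate -1.
Vertex : ℕ → Set
Vertex n = Vec Bool n

coord : Bool → ℚ
coord false = 1ℚ
coord true  = - 1ℚ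

allVertices : (n : ℕ) → List (Vertex n)
allVertices zero    = [] ∷ []
allVertices (suc n) = map (false ∷_) (allVertices n) ++ map (true ∷_) (allVertices n)

neg : ∀ {n} → Subset n → Vertex n → Vertex n
neg I v = zipWith _xor_ I v

VSet : ℕ → Set₁
VSet n = Vertex n → Set

_⊆ᵥ_ : ∀ {n} → VSet n → VSet n → Set
A ⊆ᵥ B = ∀ x → A x → B x

_≐ᵥ_ : ∀ {n} → VSet n → VSet n → Set
A ≐ᵥ B = (A ⊆ᵥ B) × (B ⊆ᵥ A)

_∪ᵥ_ : ∀ {n} → VSet n → VSet n → VSet n
(A ∪ᵥ B) x = Data.Sum._⊎_ (A x) (B x)
  where import Data.Sum

_∖ᵥ_ : ∀ {n} → VSet n → Vertex n → VSet n
(A ∖ᵥ v) x = A x × x ≢ v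

⟦_⟧ : ∀ {n} → List (Vertex n) → VSet n
⟦ xs ⟧ x = x ∈ xs

Σᵥ : ∀ {n} → (Vertex n → ℚ) → ℚ
Σᵥ {n} f = foldr (λ x acc → f x + acc) 0ℚ (allVertices n)

-- A is affinely dependent (over ℚ, equivalently over ℝ since all points are
-- integral): there is a nontrivial coefficient family supported in A with
-- Σ λ_x = 0 and Σ λ_x x = 0.
AffinelyDependent : ∀ {n} → VSet n → Set
AffinelyDependent {n} A = ∃ λ (c : Vertex n → ℚ) →
    (∀ x → c x ≢ 0ℚ → A x)
  × (∃ λ x → c x ≢ 0ℚ)
  × (Σᵥ c ≡ 0ℚ)
  × (∀ (i : Fin n) → Σᵥ (λ x → c x * coord (lookup x i)) ≡ 0ℚ)

IsCircuit : ∀ {n} → VSet n → Set₁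
IsCircuit {n} A = AffinelyDependent A
  × (∀ (B : VSet n) → B ⊆ᵥ A → (∃ λ x → A x × ¬ B x) → ¬ AffinelyDependent B)

UniqueCircuitIn : ∀ {n} → VSet n → VSet n → Set₁
UniqueCircuitIn {n} S X = IsCircuit X × (X ⊆ᵥ S)
  × (∀ (Y : VSet n) → IsCircuit Y → Y ⊆ᵥ S → Y ≐ᵥ X)

Rect : ∀ {n} → Vertex n → Subset n → Subset n → VSet n
Rect v I J = ⟦ v ∷ neg I v ∷ neg (Data.Fin.Subset._∪_ I J) v ∷ neg J v ∷ [] ⟧
  where import Data.Fin.Subset

{-# OPTIONS --safe #-}
module Submission where

-- All vertices involved are corners of the three-dimensional subcube spanned at v by the
-- blocks I, J, K, i.e. vertices obtained from v by negating a union of blocks.  An affine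
-- relation on the cube sums to zero on each side of every coordinate hyperplane; at a
-- coordinate lying in a single block this says that the coefficients on each facet of the
-- subcube sum to zero.  For each of the two five-point sets, four such facet sums force the
-- coefficient of the point off the rectangle to vanish and the coefficients on the rectangle
-- to be ±c with c ≠ 0.  So every dependent subset of the set contains the rectangle, which is
-- itself dependent; hence the rectangle is the unique circuit in the set.

open import Defs
open import Algebra.Bundles using (CommutativeMonoid)
open import Data.Nat using (ℕ)
open import Data.Bool as Bool using (Bool; true; false; not; _∧_; _∨_; _xor_; if_then_else_)
open import Data.Bool.Properties using (not-injective; not-involutive; not-distribʳ-xor; not-¬; ¬-not; ∧-identityʳ; ∧-zeroʳ; xor-comm)
open import Data.Empty using (⊥-elim)
open import Data.Fin using (Fin; zero; suc; #_)
open import Data.Fin.Subset using (Subset; Nonempty; Empty; _∩_; _∪_; ⁅_⁆) renaming (_∈_ to _∈ₛ_; ⊥ to ∅)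
open import Data.Fin.Subset.Properties using (x∈p∩q⁺; x∈p∩q⁻; x∈p∪q⁺; x∈p∪q⁻; ∩-comm; ∪-assoc)
open import Data.List using (List; []; _∷_; map; _++_; foldr; filter)
open import Data.List.Membership.Propositional using (_∈_; _∉_)
open import Data.List.Membership.Propositional.Properties using (∈-map⁻; ∈-++⁺ˡ; ∈-++⁺ʳ; ∈-++⁻)
import Data.List.Membership.DecPropositional as DecMembership
open import Data.List.Relation.Binary.Subset.Propositional using (_⊆_)
import Data.List.Relation.Binary.Subset.Propositional.Properties as ⊆
import Data.List.Relation.Binary.Subset.DecPropositional as DecSubset
open import Data.List.Relation.Unary.All as All using (All; []; _∷_)
import Data.List.Relation.Unary.All.Properties as All
open import Data.List.Relation.Unary.Any using (here; there)
open import Data.List.Relation.Unary.AllPairs using (_∷_)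
open import Data.List.Relation.Unary.Unique.Propositional using (Unique)
import Data.List.Relation.Unary.Unique.Propositional.Properties as Unique
import Data.List.Relation.Unary.Unique.DecPropositional as DecUnique
open import Data.Product using (_×_; _,_; proj₁; proj₂; ∃; ∃₂)
open import Data.Rational using (ℚ; 0ℚ; 1ℚ; ½; -_; _+_; _*_)
open import Data.Rational.Properties
  using (_≟_; +-identityˡ; +-identityʳ; +-comm; +-assoc; *-zeroˡ; *-zeroʳ; *-identityʳ; *-distribˡ-+; *-distribʳ-+; +-0-commutativeMonoid)
open import Algebra.Properties.CommutativeSemigroup (CommutativeMonoid.commutativeSemigroup +-0-commutativeMonoid)
  using (interchange)
open import Data.Rational.Solver using (module +-*-Solver)
open +-*-Solver using (solve; _:=_; _:+_; _:*_; con)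
open import Data.Sum using (inj₁; inj₂; [_,_])
open import Data.Vec using (Vec; []; _∷_; lookup)
import Data.Vec as Vec
open import Data.Vec.Properties using (≡-dec; lookup-zipWith; tabulate∘lookup; tabulate-cong; ∷-injective; []=⇒lookup; lookup⇒[]=)
open import Function using (_∘_; id)
open import Relation.Binary.Definitions using (DecidableEquality)
open import Relation.Binary.PropositionalEquality using (_≡_; _≢_; refl; sym; trans; cong; cong₂; subst; module ≡-Reasoning)
open import Relation.Nullary using (¬_; yes; no; does)
open import Relation.Nullary.Decidable using (decidable-stable; dec-true; from-yes; from-no)
open import Relation.Unary using (Decidable)

open ≡-Reasoning

private
  variable
    n k : ℕ
    A B : Set

∑ : (A → ℚ) → List A → ℚ
∑ f = foldr (λ x acc → f x + acc) 0ℚ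

_↾_ : (A → ℚ) → (A → Bool) → A → ℚ
(f ↾ p) x = if p x then f x else 0ℚ

∑-cong-All : ∀ {f g : A → ℚ} {xs} → All (λ x → f x ≡ g x) xs → ∑ f xs ≡ ∑ g xs
∑-cong-All []            = refl
∑-cong-All (fx≡gx ∷ eqs) = cong₂ _+_ fx≡gx (∑-cong-All eqs)

∑-cong : ∀ {f g : A → ℚ} → (∀ x → f x ≡ g x) → ∀ xs → ∑ f xs ≡ ∑ g xs
∑-cong f≗g xs = ∑-cong-All (All.universal f≗g xs)

∑-zero : (xs : List A) → ∑ (λ _ → 0ℚ) xs ≡ 0ℚ
∑-zero []       = refl
∑-zero (x ∷ xs) = trans (+-identityˡ _) (∑-zero xs)

∑-+ : ∀ (f g : A → ℚ) xs → ∑ (λ x → f x + g x) xs ≡ ∑ f xs + ∑ g xs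
∑-+ f g []       = refl
∑-+ f g (x ∷ xs) =
  trans (cong (f x + g x +_) (∑-+ f g xs)) (interchange (f x) (g x) (∑ f xs) (∑ g xs))

∑-*ˡ : ∀ r (f : A → ℚ) xs → ∑ (λ x → r * f x) xs ≡ r * ∑ f xs
∑-*ˡ r f []       = sym (*-zeroʳ r)
∑-*ˡ r f (x ∷ xs) = trans (cong (r * f x +_) (∑-*ˡ r f xs)) (sym (*-distribˡ-+ r (f x) (∑ f xs)))

∑-++ : ∀ (f : A → ℚ) xs ys → ∑ f (xs ++ ys) ≡ ∑ f xs + ∑ f ys
∑-++ f []       ys = sym (+-identityˡ _)
∑-++ f (x ∷ xs) ys = trans (cong (f x +_) (∑-++ f xs ys)) (sym (+-assoc (f x) _ _))

∑-map : ∀ (f : B → ℚ) (g : A → B) xs → ∑ f (map g xs) ≡ ∑ (f ∘ g) xs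
∑-map f g []       = refl
∑-map f g (x ∷ xs) = cong (f (g x) +_) (∑-map f g xs)

∑-filter : ∀ (f : A → ℚ) {P : A → Set} (P? : Decidable P) xs →
           ∑ f (filter P? xs) ≡ ∑ (f ↾ (λ x → does (P? x))) xs
∑-filter f P? []       = refl
∑-filter f P? (x ∷ xs) with does (P? x)
... | true  = cong (f x +_) (∑-filter f P? xs)
... | false = trans (∑-filter f P? xs) (sym (+-identityˡ _))

Σᵥ-cong : ∀ {f g : Vertex n → ℚ} → (∀ x → f x ≡ g x) → Σᵥ f ≡ Σᵥ g
Σᵥ-cong {n} f≗g = ∑-cong f≗g (allVertices n)

Σᵥ-zero : Σᵥ {n} (λ _ → 0ℚ) ≡ 0ℚ
Σᵥ-zero {n} = ∑-zero (allVertices n)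

Σᵥ-+ : ∀ (f g : Vertex n → ℚ) → Σᵥ (λ x → f x + g x) ≡ Σᵥ f + Σᵥ g
Σᵥ-+ {n} f g = ∑-+ f g (allVertices n)

Σᵥ-*ˡ : ∀ r (f : Vertex n → ℚ) → Σᵥ (λ x → r * f x) ≡ r * Σᵥ f
Σᵥ-*ˡ {n} r f = ∑-*ˡ r f (allVertices n)

_≟ᵥ_ : DecidableEquality (Vec Bool n)
_≟ᵥ_ = ≡-dec Bool._≟_

δ : Vertex n → ℚ → Vertex n → ℚ
δ p r x = if does (x ≟ᵥ p) then r else 0ℚ

δ-self : ∀ (p : Vertex n) r → δ p r p ≡ r
δ-self p r = cong (λ b → if b then r else 0ℚ) (dec-true (p ≟ᵥ p) refl)

δ-* : ∀ (p : Vertex n) r (g : Vertex n → ℚ) x → δ p r x * g x ≡ δ p (r * g p) x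
δ-* p r g x with x ≟ᵥ p
... | yes refl = refl
... | no  _    = *-zeroˡ (g x)

Σᵥ-δ : ∀ (p : Vertex n) r → Σᵥ (δ p r) ≡ r
Σᵥ-δ {ℕ.zero}  []      r = +-identityʳ r
Σᵥ-δ {ℕ.suc n} (b ∷ p) r = begin
    ∑ (δ (b ∷ p) r) (map (false ∷_) vs ++ map (true ∷_) vs)
  ≡⟨ ∑-++ (δ (b ∷ p) r) (map (false ∷_) vs) _ ⟩
    ∑ (δ (b ∷ p) r) (map (false ∷_) vs) + ∑ (δ (b ∷ p) r) (map (true ∷_) vs)
  ≡⟨ cong₂ _+_ (∑-map (δ (b ∷ p) r) (false ∷_) vs) (∑-map (δ (b ∷ p) r) (true ∷_) vs) ⟩
    ∑ (δ (b ∷ p) r ∘ (false ∷_)) vs + ∑ (δ (b ∷ p) r ∘ (true ∷_)) vs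
  ≡⟨ halves b ⟩
    r ∎
  where
  vs = allVertices n
  halves : ∀ b → ∑ (δ (b ∷ p) r ∘ (false ∷_)) vs + ∑ (δ (b ∷ p) r ∘ (true ∷_)) vs ≡ r
  halves false = trans (cong₂ _+_ (Σᵥ-δ p r) (∑-zero vs)) (+-identityʳ r)
  halves true  = trans (cong₂ _+_ (∑-zero vs) (Σᵥ-δ p r)) (+-identityˡ r)

Σᵥ-δ-* : ∀ (p : Vertex n) r (g : Vertex n → ℚ) → Σᵥ (λ x → δ p r x * g x) ≡ r * g p
Σᵥ-δ-* p r g = trans (Σᵥ-cong (δ-* p r g)) (Σᵥ-δ p (r * g p))

Supported : (Vertex n → ℚ) → List (Vertex n) → Set
Supported f L = ∀ x → f x ≢ 0ℚ → x ∈ L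

NonTrivial : (Vertex n → ℚ) → Set
NonTrivial f = ∃ λ x → f x ≢ 0ℚ

vanishes-off-support : ∀ {f : Vertex n → ℚ} {L} → Supported f L → ∀ x → x ∉ L → f x ≡ 0ℚ
vanishes-off-support {f = f} supp x x∉L = decidable-stable (f x ≟ 0ℚ) (x∉L ∘ supp x)

↾-supported : ∀ {f : Vertex n → ℚ} {L} (p : Vertex n → Bool) → Supported f L → Supported (f ↾ p) L
↾-supported p supp x fx≢0 with p x
... | true  = supp x fx≢0
... | false = ⊥-elim (fx≢0 refl)

nonzero-on-support : ∀ {f : Vertex n → ℚ} {L} → Supported f L → NonTrivial f → ¬ All (λ x → f x ≡ 0ℚ) L
nonzero-on-support supp (x , fx≢0) all-zero = fx≢0 (All.lookup all-zero (supp x fx≢0))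

Σᵥ-supported : ∀ {f : Vertex n → ℚ} {L} → Unique L → Supported f L → Σᵥ f ≡ ∑ f L
Σᵥ-supported {n} {f} {[]} _ supp =
  trans (Σᵥ-cong {g = λ _ → 0ℚ} (λ x → vanishes-off-support supp x λ ())) (Σᵥ-zero {n})
Σᵥ-supported {f = f} {p ∷ L} (p∉L ∷ unique) supp = begin
    Σᵥ f
  ≡⟨ Σᵥ-cong split ⟩
    Σᵥ (λ x → δ p (f p) x + f-p x)
  ≡⟨ Σᵥ-+ (δ p (f p)) f-p ⟩
    Σᵥ (δ p (f p)) + Σᵥ f-p
  ≡⟨ cong₂ _+_ (Σᵥ-δ p (f p)) (Σᵥ-supported unique supp-p) ⟩
    f p + ∑ f-p L
  ≡⟨ cong (f p +_) (∑-cong-All (All.map agree p∉L)) ⟩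
    f p + ∑ f L ∎
  where
  f-p = f ↾ (λ x → not (does (x ≟ᵥ p)))
  split : ∀ x → f x ≡ δ p (f p) x + f-p x
  split x with x ≟ᵥ p
  ... | yes refl = sym (+-identityʳ (f x))
  ... | no  _    = sym (+-identityˡ (f x))
  supp-p : Supported f-p L
  supp-p x fx≢0 with x ≟ᵥ p
  ... | yes _   = ⊥-elim (fx≢0 refl)
  ... | no  x≢p with supp x fx≢0
  ...   | here x≡p  = ⊥-elim (x≢p x≡p)
  ...   | there x∈L = x∈L
  agree : ∀ {y} → p ≢ y → f-p y ≡ f y
  agree {y} p≢y with y ≟ᵥ p
  ... | yes y≡p = ⊥-elim (p≢y (sym y≡p))
  ... | no  _   = refl

-- Affine relations and circuits

IsAffineRelation : (Vertex n → ℚ) → Set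
IsAffineRelation {n} c = Σᵥ c ≡ 0ℚ × (∀ (m : Fin n) → Σᵥ (λ x → c x * coord (lookup x m)) ≡ 0ℚ)

-- The indicator of a = b is (1 + coord a · coord b) / 2.
indicator-by-signs : ∀ y a b → (if does (a Bool.≟ b) then y else 0ℚ) ≡ ½ * (y + coord b * (y * coord a))
indicator-by-signs y false false = solve 1 (λ y → y := con ½ :* (y :+ con 1ℚ :* (y :* con 1ℚ))) refl y
indicator-by-signs y false true  = solve 1 (λ y → con 0ℚ := con ½ :* (y :+ con (- 1ℚ) :* (y :* con 1ℚ))) refl y
indicator-by-signs y true  false = solve 1 (λ y → con 0ℚ := con ½ :* (y :+ con 1ℚ :* (y :* con (- 1ℚ)))) refl y
indicator-by-signs y true  true  = solve 1 (λ y → y := con ½ :* (y :+ con (- 1ℚ) :* (y :* con (- 1ℚ)))) refl y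

facet-balance : ∀ {c : Vertex n → ℚ} → IsAffineRelation c →
                ∀ m b → Σᵥ (c ↾ (λ x → does (lookup x m Bool.≟ b))) ≡ 0ℚ
facet-balance {c = c} (Σc≡0 , Σcx≡0) m b = begin
    Σᵥ (c ↾ (λ x → does (lookup x m Bool.≟ b)))
  ≡⟨ Σᵥ-cong (λ x → indicator-by-signs (c x) (lookup x m) b) ⟩
    Σᵥ (λ x → ½ * (c x + coord b * cₘ x))
  ≡⟨ Σᵥ-*ˡ ½ (λ x → c x + coord b * cₘ x) ⟩
    ½ * Σᵥ (λ x → c x + coord b * cₘ x)
  ≡⟨ cong (½ *_) (Σᵥ-+ c (λ x → coord b * cₘ x)) ⟩
    ½ * (Σᵥ c + Σᵥ (λ x → coord b * cₘ x))
  ≡⟨ cong (λ t → ½ * (Σᵥ c + t)) (Σᵥ-*ˡ (coord b) cₘ) ⟩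
    ½ * (Σᵥ c + coord b * Σᵥ cₘ)
  ≡⟨ cong₂ (λ s t → ½ * (s + coord b * t)) Σc≡0 (Σcx≡0 m) ⟩
    ½ * (0ℚ + coord b * 0ℚ)
  ≡⟨ cong (λ t → ½ * (0ℚ + t)) (*-zeroʳ (coord b)) ⟩
    0ℚ ∎
  where
  cₘ : Vertex _ → ℚ
  cₘ x = c x * coord (lookup x m)

EveryRelationOn_Uses_ : List (Vertex n) → List (Vertex n) → Set
EveryRelationOn L Uses X =
  ∀ c → IsAffineRelation c → Supported c L → NonTrivial c → All (λ x → c x ≢ 0ℚ) X

dependent-subsets-contain : ∀ {S : VSet n} {L X} → S ⊆ᵥ ⟦ L ⟧ → EveryRelationOn L Uses X →
                            ∀ B → B ⊆ᵥ S → AffinelyDependent B → ⟦ X ⟧ ⊆ᵥ B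
dependent-subsets-contain S⊆L uses B B⊆S (c , c⊆B , nontrivial , relation) x x∈X =
  c⊆B x (All.lookup (uses c relation supported nontrivial) x∈X)
  where
  supported : Supported c _
  supported y cy≢0 = S⊆L y (B⊆S y (c⊆B y cy≢0))

unique-circuit : ∀ {S : VSet n} {X} → AffinelyDependent ⟦ X ⟧ → ⟦ X ⟧ ⊆ᵥ S →
                 (∀ B → B ⊆ᵥ S → AffinelyDependent B → ⟦ X ⟧ ⊆ᵥ B) → UniqueCircuitIn S ⟦ X ⟧
unique-circuit {n} {S} {X} dep X⊆S X⊆dependent = (dep , minimal) , X⊆S , unique
  where
  open DecMembership (_≟ᵥ_ {n}) using (_∈?_)
  minimal : ∀ B → B ⊆ᵥ ⟦ X ⟧ → (∃ λ x → ⟦ X ⟧ x × ¬ B x) → ¬ AffinelyDependent B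
  minimal B B⊆X (x , x∈X , x∉B) depB = x∉B (X⊆dependent B (λ y → X⊆S y ∘ B⊆X y) depB x x∈X)
  unique : ∀ Y → IsCircuit Y → Y ⊆ᵥ S → Y ≐ᵥ ⟦ X ⟧
  unique Y (depY , minY) Y⊆S = Y⊆X , X⊆Y
    where
    X⊆Y : ⟦ X ⟧ ⊆ᵥ Y
    X⊆Y = X⊆dependent Y Y⊆S depY
    Y⊆X : Y ⊆ᵥ ⟦ X ⟧
    Y⊆X y y∈Y = decidable-stable (y ∈? X) (λ y∉X → minY ⟦ X ⟧ X⊆Y (y , y∈Y , y∉X) dep)

subst-unique-circuit : ∀ {A A′ B B′ X X′ : VSet n} {o} → A ≡ A′ → B ≡ B′ → X ≡ X′ →
                       UniqueCircuitIn ((A′ ∪ᵥ B′) ∖ᵥ o) X′ → UniqueCircuitIn ((A ∪ᵥ B) ∖ᵥ o) X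
subst-unique-circuit refl refl refl = id

∉-map⁺ : ∀ {f : A → B} → (∀ {x y} → f x ≡ f y → x ≡ y) → ∀ {o xs} → o ∉ xs → f o ∉ map f xs
∉-map⁺ {f = f} f-injective o∉xs fo∈ with ∈-map⁻ f fo∈
... | s , s∈xs , fo≡fs = o∉xs (subst (_∈ _) (sym (f-injective fo≡fs)) s∈xs)

∪ᵥ-∖ᵥ-⊆ : ∀ {L₁ L₂ L : List (Vertex n)} {o} → L₁ ++ L₂ ⊆ o ∷ L → ((⟦ L₁ ⟧ ∪ᵥ ⟦ L₂ ⟧) ∖ᵥ o) ⊆ᵥ ⟦ L ⟧
∪ᵥ-∖ᵥ-⊆ {L₁ = L₁} cover x (x∈L₁∪L₂ , x≢o) with cover ([ ∈-++⁺ˡ , ∈-++⁺ʳ L₁ ] x∈L₁∪L₂)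
... | here x≡o  = ⊥-elim (x≢o x≡o)
... | there x∈L = x∈L

⊆-∪ᵥ-∖ᵥ : ∀ {X L₁ L₂ : List (Vertex n)} {o} → X ⊆ L₁ ++ L₂ → o ∉ X → ⟦ X ⟧ ⊆ᵥ ((⟦ L₁ ⟧ ∪ᵥ ⟦ L₂ ⟧) ∖ᵥ o)
⊆-∪ᵥ-∖ᵥ {L₁ = L₁} X⊆L₁++L₂ o∉X x x∈X = ∈-++⁻ L₁ (X⊆L₁++L₂ x∈X) , λ { refl → o∉X x∈X }

-- Negating blocks of coordinates

lookup-neg : ∀ (P : Subset n) x m → lookup (neg P x) m ≡ lookup P m xor lookup x m
lookup-neg P x m = lookup-zipWith _xor_ m P x

lookup-∪ : ∀ (P Q : Subset n) m → lookup (P ∪ Q) m ≡ lookup P m ∨ lookup Q m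
lookup-∪ P Q m = lookup-zipWith _∨_ m P Q

lookup-extensionality : ∀ {xs ys : Vec Bool n} → (∀ m → lookup xs m ≡ lookup ys m) → xs ≡ ys
lookup-extensionality {xs = xs} {ys} eq =
  trans (sym (tabulate∘lookup xs)) (trans (tabulate-cong eq) (tabulate∘lookup ys))

disjoint-at : ∀ {P Q : Subset n} → Empty (P ∩ Q) → ∀ m → lookup P m ∧ lookup Q m ≡ false
disjoint-at {P = P} {Q} P∩Q≡∅ m =
  ¬-not (λ both → P∩Q≡∅ (m , lookup⇒[]= m (P ∩ Q) (trans (lookup-zipWith _∧_ m P Q) both)))

disjoint-∉ʳ : ∀ {P Q : Subset n} {m} → Empty (P ∩ Q) → m ∈ₛ P → lookup Q m ≡ false
disjoint-∉ʳ {Q = Q} {m} P∩Q≡∅ m∈P =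
  subst (λ p → p ∧ lookup Q m ≡ false) ([]=⇒lookup m∈P) (disjoint-at P∩Q≡∅ m)

disjoint-∉ˡ : ∀ {P Q : Subset n} {m} → Empty (P ∩ Q) → m ∈ₛ Q → lookup P m ≡ false
disjoint-∉ˡ {P = P} {m = m} P∩Q≡∅ m∈Q =
  trans (sym (∧-identityʳ (lookup P m))) (subst (λ q → lookup P m ∧ q ≡ false) ([]=⇒lookup m∈Q) (disjoint-at P∩Q≡∅ m))

∩-∪-empty : ∀ {P Q R : Subset n} → Empty (P ∩ Q) → Empty (P ∩ R) → Empty (P ∩ (Q ∪ R))
∩-∪-empty {P = P} {Q} {R} P∩Q≡∅ P∩R≡∅ (m , m∈P∩[Q∪R]) with x∈p∩q⁻ P (Q ∪ R) m∈P∩[Q∪R]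
... | m∈P , m∈Q∪R with x∈p∪q⁻ Q R m∈Q∪R
...   | inj₁ m∈Q = P∩Q≡∅ (m , x∈p∩q⁺ (m∈P , m∈Q))
...   | inj₂ m∈R = P∩R≡∅ (m , x∈p∩q⁺ (m∈P , m∈R))

∪-nonemptyˡ : ∀ {P Q : Subset n} → Nonempty P → Nonempty (P ∪ Q)
∪-nonemptyˡ (m , m∈P) = m , x∈p∪q⁺ (inj₁ m∈P)

neg-moves : ∀ {P : Subset n} {x} → Nonempty P → neg P x ≢ x
neg-moves {P = P} {x} (m , m∈P) negPx≡x = not-¬ refl (begin
    lookup x m
  ≡⟨ cong (λ y → lookup y m) negPx≡x ⟨
    lookup (neg P x) m
  ≡⟨ lookup-neg P x m ⟩
    lookup P m xor lookup x m
  ≡⟨ cong (_xor lookup x m) ([]=⇒lookup m∈P) ⟩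
    not (lookup x m) ∎)

neg-involutive : ∀ (P : Subset n) x → neg P (neg P x) ≡ x
neg-involutive []          []      = refl
neg-involutive (false ∷ P) (b ∷ x) = cong (b ∷_) (neg-involutive P x)
neg-involutive (true  ∷ P) (b ∷ x) = cong₂ _∷_ (not-involutive b) (neg-involutive P x)

neg-comm : ∀ (P Q : Subset n) x → neg P (neg Q x) ≡ neg Q (neg P x)
neg-comm []          []      []      = refl
neg-comm (false ∷ P) (q ∷ Q) (b ∷ x) = cong ((q xor b) ∷_) (neg-comm P Q x)
neg-comm (true  ∷ P) (q ∷ Q) (b ∷ x) = cong₂ _∷_ (not-distribʳ-xor q b) (neg-comm P Q x)

∨-xor : ∀ p q b → p ∧ q ≡ false → (p ∨ q) xor b ≡ p xor (q xor b)
∨-xor false q     b _ = refl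
∨-xor true  false b _ = refl
∨-xor true  true  b ()

neg-∪ : ∀ {P Q : Subset n} → Empty (P ∩ Q) → ∀ x → neg (P ∪ Q) x ≡ neg P (neg Q x)
neg-∪ {P = P} {Q} P∩Q≡∅ x = lookup-extensionality λ m → begin
    lookup (neg (P ∪ Q) x) m
  ≡⟨ trans (lookup-neg (P ∪ Q) x m) (cong (_xor lookup x m) (lookup-∪ P Q m)) ⟩
    (lookup P m ∨ lookup Q m) xor lookup x m
  ≡⟨ ∨-xor (lookup P m) (lookup Q m) (lookup x m) (disjoint-at P∩Q≡∅ m) ⟩
    lookup P m xor (lookup Q m xor lookup x m)
  ≡⟨ trans (lookup-neg P (neg Q x) m) (cong (lookup P m xor_) (lookup-neg Q x m)) ⟨
    lookup (neg P (neg Q x)) m ∎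

neg-∪-cancelˡ : ∀ {P Q : Subset n} → Empty (P ∩ Q) → ∀ x → neg (P ∪ Q) (neg P x) ≡ neg Q x
neg-∪-cancelˡ {P = P} {Q} P∩Q≡∅ x = begin
    neg (P ∪ Q) (neg P x)
  ≡⟨ neg-∪ P∩Q≡∅ (neg P x) ⟩
    neg P (neg Q (neg P x))
  ≡⟨ cong (neg P) (neg-comm Q P x) ⟩
    neg P (neg P (neg Q x))
  ≡⟨ neg-involutive P (neg Q x) ⟩
    neg Q x ∎

-- Rectangles

combination : List (Vertex n × ℚ) → Vertex n → ℚ
combination ts x = ∑ (λ t → δ (proj₁ t) (proj₂ t) x) ts

combination-supported : ∀ (ts : List (Vertex n × ℚ)) → Supported (combination ts) (map proj₁ ts)
combination-supported []             x c≢0 = ⊥-elim (c≢0 refl)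
combination-supported ((p , r) ∷ ts) x c≢0 with x ≟ᵥ p
... | yes x≡p = here x≡p
... | no  _   = there (combination-supported ts x (c≢0 ∘ trans (+-identityˡ _)))

combination-head : ∀ {p : Vertex n} {r} ts → p ∉ map proj₁ ts → combination ((p , r) ∷ ts) p ≡ r
combination-head {p = p} {r} ts p∉ts =
  trans (cong₂ _+_ (δ-self p r) (vanishes-off-support (combination-supported ts) p p∉ts)) (+-identityʳ r)

Σᵥ-combination : ∀ (ts : List (Vertex n × ℚ)) (g : Vertex n → ℚ) →
                 Σᵥ (λ x → combination ts x * g x) ≡ ∑ (λ t → proj₂ t * g (proj₁ t)) ts
Σᵥ-combination {n} []             g = trans (Σᵥ-cong {g = λ _ → 0ℚ} (λ x → *-zeroˡ (g x))) (Σᵥ-zero {n})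
Σᵥ-combination     ((p , r) ∷ ts) g = begin
    Σᵥ (λ x → (δ p r x + combination ts x) * g x)
  ≡⟨ Σᵥ-cong (λ x → *-distribʳ-+ (g x) (δ p r x) (combination ts x)) ⟩
    Σᵥ (λ x → δ p r x * g x + combination ts x * g x)
  ≡⟨ Σᵥ-+ (λ x → δ p r x * g x) (λ x → combination ts x * g x) ⟩
    Σᵥ (λ x → δ p r x * g x) + Σᵥ (λ x → combination ts x * g x)
  ≡⟨ cong₂ _+_ (Σᵥ-δ-* p r g) (Σᵥ-combination ts g) ⟩
    r * g p + ∑ (λ t → proj₂ t * g (proj₁ t)) ts ∎

rectangle-relation : Vertex n → Subset n → Subset n → List (Vertex n × ℚ)
rectangle-relation u P Q = (u , 1ℚ) ∷ (neg P u , - 1ℚ) ∷ (neg (P ∪ Q) u , 1ℚ) ∷ (neg Q u , - 1ℚ) ∷ []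

rectangle-signs : ∀ {b b₁ b₂ b₃} p q → p ∧ q ≡ false →
                  b₁ ≡ p xor b → b₂ ≡ (p ∨ q) xor b → b₃ ≡ q xor b →
                  1ℚ * coord b + (- 1ℚ * coord b₁ + (1ℚ * coord b₂ + (- 1ℚ * coord b₃ + 0ℚ))) ≡ 0ℚ
rectangle-signs {false} false false _ refl refl refl = refl
rectangle-signs {true}  false false _ refl refl refl = refl
rectangle-signs {false} true  false _ refl refl refl = refl
rectangle-signs {true}  true  false _ refl refl refl = refl
rectangle-signs {false} false true  _ refl refl refl = refl
rectangle-signs {true}  false true  _ refl refl refl = refl
rectangle-signs         true  true  ()

rectangle-dependent : ∀ {u : Vertex n} {P Q} → Nonempty P → Nonempty Q → Empty (P ∩ Q) →
                      AffinelyDependent (Rect u P Q)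
rectangle-dependent {u = u} {P} {Q} P≢∅ Q≢∅ P∩Q≡∅ =
  c , combination-supported ts , (u , c[u]≢0) , Σc≡0 , Σcₘ≡0
  where
  ts = rectangle-relation u P Q
  c = combination ts
  u∉others : u ∉ neg P u ∷ neg (P ∪ Q) u ∷ neg Q u ∷ []
  u∉others (here u≡)                 = neg-moves P≢∅ (sym u≡)
  u∉others (there (here u≡))         = neg-moves (∪-nonemptyˡ P≢∅) (sym u≡)
  u∉others (there (there (here u≡))) = neg-moves Q≢∅ (sym u≡)
  c[u]≢0 : c u ≢ 0ℚ
  c[u]≢0 c[u]≡0 with () ← trans (sym (combination-head _ u∉others)) c[u]≡0
  Σc≡0 : Σᵥ c ≡ 0ℚ
  Σc≡0 = trans (Σᵥ-cong (λ x → sym (*-identityʳ (c x)))) (Σᵥ-combination ts (λ _ → 1ℚ))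
  Σcₘ≡0 : ∀ m → Σᵥ (λ x → c x * coord (lookup x m)) ≡ 0ℚ
  Σcₘ≡0 m = trans (Σᵥ-combination ts (λ x → coord (lookup x m)))
    (rectangle-signs (lookup P m) (lookup Q m) (disjoint-at P∩Q≡∅ m) (lookup-neg P u m)
      (trans (lookup-neg (P ∪ Q) u m) (cong (_xor lookup u m) (lookup-∪ P Q m))) (lookup-neg Q u m))

x+y≡0∧x≡0⇒y≡0 : ∀ {x y : ℚ} → x + y ≡ 0ℚ → x ≡ 0ℚ → y ≡ 0ℚ
x+y≡0∧x≡0⇒y≡0 {y = y} x+y≡0 refl = trans (sym (+-identityˡ y)) x+y≡0

x+y≡0∧y≡0⇒x≡0 : ∀ {x y : ℚ} → x + y ≡ 0ℚ → y ≡ 0ℚ → x ≡ 0ℚ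
x+y≡0∧y≡0⇒x≡0 {x} {y} x+y≡0 = x+y≡0∧x≡0⇒y≡0 (trans (+-comm y x) x+y≡0)

rectangle-coefficients-nonzero : ∀ {a x₁ x₂ x₃ x₄ : ℚ} →
  x₁ + x₂ ≡ 0ℚ → x₃ + x₄ ≡ 0ℚ → x₁ + x₄ ≡ 0ℚ → a + (x₃ + x₄) ≡ 0ℚ →
  ¬ All (_≡ 0ℚ) (a ∷ x₁ ∷ x₂ ∷ x₃ ∷ x₄ ∷ []) → All (_≢ 0ℚ) (x₁ ∷ x₂ ∷ x₃ ∷ x₄ ∷ [])
rectangle-coefficients-nonzero {x₁ = x₁} e₁₂ e₃₄ e₁₄ eₐ₃₄ not-all-zero =
  x₁≢0 ∷ (x₁≢0 ∘ x+y≡0∧y≡0⇒x≡0 e₁₂) ∷ (x₁≢0 ∘ x+y≡0∧y≡0⇒x≡0 e₁₄ ∘ x+y≡0∧x≡0⇒y≡0 e₃₄)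
       ∷ (x₁≢0 ∘ x+y≡0∧y≡0⇒x≡0 e₁₄) ∷ []
  where
  x₁≢0 : x₁ ≢ 0ℚ
  x₁≢0 x₁≡0 = not-all-zero (a≡0 ∷ x₁≡0 ∷ x+y≡0∧x≡0⇒y≡0 e₁₂ x₁≡0 ∷ x₃≡0 ∷ x₄≡0 ∷ [])
    where
    x₄≡0 = x+y≡0∧x≡0⇒y≡0 e₁₄ x₁≡0
    x₃≡0 = x+y≡0∧y≡0⇒x≡0 e₃₄ x₄≡0
    a≡0  = x+y≡0∧y≡0⇒x≡0 eₐ₃₄ e₃₄

-- The subcube spanned by disjoint blocks

xor-cancelˡ : ∀ u {a b} → u xor a ≡ u xor b → a ≡ b
xor-cancelˡ false eq = eq
xor-cancelˡ true  eq = not-injective eq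

≟-xorˡ : ∀ u a b → does ((u xor a) Bool.≟ (u xor b)) ≡ does (a Bool.≟ b)
≟-xorˡ false a     b     = refl
≟-xorˡ true  false false = refl
≟-xorˡ true  false true  = refl
≟-xorˡ true  true  false = refl
≟-xorˡ true  true  true  = refl

negate-blocks : Vec (Subset n) k → Subset k → Vertex n → Vertex n
negate-blocks []       []      x = x
negate-blocks (P ∷ Ps) (a ∷ s) x = if a then neg P (negate-blocks Ps s x) else negate-blocks Ps s x

blocks-at : Vec (Subset n) k → Fin n → Subset k
blocks-at Ps m = Vec.map (λ P → lookup P m) Ps

-- lookup P m ∧ a, unlike a ∧ lookup P m, reduces as soon as lookup P m is known.
lookup-if-neg : ∀ a (P : Subset n) y m → lookup (if a then neg P y else y) m ≡ (lookup P m ∧ a) xor lookup y m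
lookup-if-neg true  P y m = trans (lookup-neg P y m) (cong (_xor lookup y m) (sym (∧-identityʳ (lookup P m))))
lookup-if-neg false P y m = cong (_xor lookup y m) (sym (∧-zeroʳ (lookup P m)))

lookup-negate-blocks-outside : ∀ (Ps : Vec (Subset n) k) s x m → blocks-at Ps m ≡ ∅ →
                               lookup (negate-blocks Ps s x) m ≡ lookup x m
lookup-negate-blocks-outside []       []      x m _ = refl
lookup-negate-blocks-outside (P ∷ Ps) (a ∷ s) x m eq with ∷-injective eq
... | Pₘ≡false , rest = trans (lookup-if-neg a P (negate-blocks Ps s x) m)
  (cong₂ (λ p y → (p ∧ a) xor y) Pₘ≡false (lookup-negate-blocks-outside Ps s x m rest))

lookup-negate-blocks : ∀ (Ps : Vec (Subset n) k) s x m d → blocks-at Ps m ≡ ⁅ d ⁆ →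
                       lookup (negate-blocks Ps s x) m ≡ lookup x m xor lookup s d
lookup-negate-blocks (P ∷ Ps) (a ∷ s) x m zero eq with ∷-injective eq
... | Pₘ≡true , rest = begin
    lookup (negate-blocks (P ∷ Ps) (a ∷ s) x) m
  ≡⟨ lookup-if-neg a P (negate-blocks Ps s x) m ⟩
    (lookup P m ∧ a) xor lookup (negate-blocks Ps s x) m
  ≡⟨ cong₂ (λ p y → (p ∧ a) xor y) Pₘ≡true (lookup-negate-blocks-outside Ps s x m rest) ⟩
    a xor lookup x m
  ≡⟨ xor-comm a (lookup x m) ⟩
    lookup x m xor a ∎
lookup-negate-blocks (P ∷ Ps) (a ∷ s) x m (suc d) eq with ∷-injective eq
... | Pₘ≡false , rest = trans (lookup-if-neg a P (negate-blocks Ps s x) m)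
  (cong₂ (λ p y → (p ∧ a) xor y) Pₘ≡false (lookup-negate-blocks Ps s x m d rest))

module Subcube (Ps : Vec (Subset n) k) (v : Vertex n) (witness : Fin k → Fin n)
               (witness-private : ∀ d → blocks-at Ps (witness d) ≡ ⁅ d ⁆) where

  corner : Subset k → Vertex n
  corner s = negate-blocks Ps s v

  lookup-corner : ∀ s d → lookup (corner s) (witness d) ≡ lookup v (witness d) xor lookup s d
  lookup-corner s d = lookup-negate-blocks Ps s v (witness d) d (witness-private d)

  corner-injective : ∀ {s t} → corner s ≡ corner t → s ≡ t
  corner-injective {s} {t} eq = lookup-extensionality λ d → xor-cancelˡ (lookup v (witness d)) (begin
      lookup v (witness d) xor lookup s d
    ≡⟨ lookup-corner s d ⟨
      lookup (corner s) (witness d)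
    ≡⟨ cong (λ x → lookup x (witness d)) eq ⟩
      lookup (corner t) (witness d)
    ≡⟨ lookup-corner t d ⟩
      lookup v (witness d) xor lookup t d ∎)

  FacetSlice : List (Subset k) → List (Subset k) → Set
  FacetSlice ss ts = ∃₂ λ d b → filter (λ s → lookup s d Bool.≟ b) ss ≡ ts

  facet-slice-balance : ∀ {c ss ts} → IsAffineRelation c → Supported c (map corner ss) → Unique ss →
                        FacetSlice ss ts → ∑ (c ∘ corner) ts ≡ 0ℚ
  facet-slice-balance {c} {ss} relation supported unique (d , b , refl) = begin
      ∑ (c ∘ corner) (filter (λ s → lookup s d Bool.≟ b) ss)
    ≡⟨ ∑-filter (c ∘ corner) (λ s → lookup s d Bool.≟ b) ss ⟩
      ∑ ((c ∘ corner) ↾ (λ s → does (lookup s d Bool.≟ b))) ss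
    ≡⟨ ∑-cong (λ s → cong (λ t → if t then c (corner s) else 0ℚ) (in-facet s)) ss ⟩
      ∑ ((c ↾ facet) ∘ corner) ss
    ≡⟨ ∑-map (c ↾ facet) corner ss ⟨
      ∑ (c ↾ facet) (map corner ss)
    ≡⟨ Σᵥ-supported (Unique.map⁺ corner-injective unique) (↾-supported facet supported) ⟨
      Σᵥ (c ↾ facet)
    ≡⟨ facet-balance relation m (lookup v m xor b) ⟩
      0ℚ ∎
    where
    m = witness d
    -- The facet s_d ≡ b of the subcube lies in the facet x_m ≡ v_m xor b of the cube.
    facet : Vertex n → Bool
    facet x = does (lookup x m Bool.≟ (lookup v m xor b))
    in-facet : ∀ s → does (lookup s d Bool.≟ b) ≡ facet (corner s)
    in-facet s = trans (sym (≟-xorˡ (lookup v m) (lookup s d) b))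
      (cong (λ y → does (y Bool.≟ (lookup v m xor b))) (sym (lookup-corner s d)))

  five-point-rigidity : ∀ {a x₁ x₂ x₃ x₄} → let ss = a ∷ x₁ ∷ x₂ ∷ x₃ ∷ x₄ ∷ [] in
    Unique ss → FacetSlice ss (x₁ ∷ x₂ ∷ []) → FacetSlice ss (x₃ ∷ x₄ ∷ []) →
    FacetSlice ss (x₁ ∷ x₄ ∷ []) → FacetSlice ss (a ∷ x₃ ∷ x₄ ∷ []) →
    EveryRelationOn map corner ss Uses map corner (x₁ ∷ x₂ ∷ x₃ ∷ x₄ ∷ [])
  five-point-rigidity {a} {x₁} {x₂} {x₃} {x₄} unique F₁₂ F₃₄ F₁₄ Fₐ₃₄ c relation supported nontrivial =
    All.map⁻ {f = c} (rectangle-coefficients-nonzero (pair F₁₂) (pair F₃₄) (pair F₁₄) (triple Fₐ₃₄)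
      (nonzero-on-support supported nontrivial ∘ All.map⁻ {f = c}))
    where
    ss = a ∷ x₁ ∷ x₂ ∷ x₃ ∷ x₄ ∷ []
    balance : ∀ {ts} → FacetSlice ss ts → ∑ (c ∘ corner) ts ≡ 0ℚ
    balance = facet-slice-balance relation supported unique
    pair : ∀ {x y} → FacetSlice ss (x ∷ y ∷ []) → c (corner x) + c (corner y) ≡ 0ℚ
    pair {x} {y} F = trans (cong (c (corner x) +_) (sym (+-identityʳ (c (corner y))))) (balance F)
    triple : ∀ {x y z} → FacetSlice ss (x ∷ y ∷ z ∷ []) → c (corner x) + (c (corner y) + c (corner z)) ≡ 0ℚ
    triple {x} {y} {z} F =
      trans (cong (λ t → c (corner x) + (c (corner y) + t)) (sym (+-identityʳ (c (corner z))))) (balance F)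

module ThreeBlocks (v : Vertex n) (I J K : Subset n)
                   (I∩J≡∅ : Empty (I ∩ J)) (I∩K≡∅ : Empty (I ∩ K)) (J∩K≡∅ : Empty (J ∩ K))
                   (i j k : Fin n) (i∈I : i ∈ₛ I) (j∈J : j ∈ₛ J) (k∈K : k ∈ₛ K) where

  witness : Fin 3 → Fin n
  witness zero             = i
  witness (suc zero)       = j
  witness (suc (suc zero)) = k

  blocks-at-≡ : ∀ {m a b c} → lookup I m ≡ a → lookup J m ≡ b → lookup K m ≡ c →
                blocks-at (I ∷ J ∷ K ∷ []) m ≡ a ∷ b ∷ c ∷ []
  blocks-at-≡ refl refl refl = refl

  witness-private : ∀ d → blocks-at (I ∷ J ∷ K ∷ []) (witness d) ≡ ⁅ d ⁆
  witness-private zero =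
    blocks-at-≡ ([]=⇒lookup i∈I) (disjoint-∉ʳ I∩J≡∅ i∈I) (disjoint-∉ʳ I∩K≡∅ i∈I)
  witness-private (suc zero) =
    blocks-at-≡ (disjoint-∉ˡ I∩J≡∅ j∈J) ([]=⇒lookup j∈J) (disjoint-∉ʳ J∩K≡∅ j∈J)
  witness-private (suc (suc zero)) =
    blocks-at-≡ (disjoint-∉ˡ I∩K≡∅ k∈K) (disjoint-∉ˡ J∩K≡∅ k∈K) ([]=⇒lookup k∈K)

  open Subcube (I ∷ J ∷ K ∷ []) v witness witness-private
  open DecMembership (_≟ᵥ_ {3}) using (_∈?_)
  open DecSubset (_≟ᵥ_ {3}) using (_⊆?_)
  open DecUnique (_≟ᵥ_ {3}) using (unique?)

  -- corner (𝐈 ∪ 𝐉) is v with the blocks I and J negated.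
  𝐈 𝐉 𝐊 : Subset 3
  𝐈 = ⁅ # 0 ⁆
  𝐉 = ⁅ # 1 ⁆
  𝐊 = ⁅ # 2 ⁆

  J∩I≡∅ : Empty (J ∩ I)
  J∩I≡∅ = subst Empty (∩-comm I J) I∩J≡∅

  I∩[J∪K]≡∅ : Empty (I ∩ (J ∪ K))
  I∩[J∪K]≡∅ = ∩-∪-empty I∩J≡∅ I∩K≡∅

  J∩[I∪K]≡∅ : Empty (J ∩ (I ∪ K))
  J∩[I∪K]≡∅ = ∩-∪-empty J∩I≡∅ J∩K≡∅

  I≢∅ : Nonempty I
  I≢∅ = i , i∈I

  J≢∅ : Nonempty J
  J≢∅ = j , j∈J

  neg-IJK : neg (I ∪ (J ∪ K)) v ≡ neg I (neg J (neg K v))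
  neg-IJK = trans (neg-∪ I∩[J∪K]≡∅ v) (cong (neg I) (neg-∪ J∩K≡∅ v))

  Rect-v-I-J : Rect v I J ≡ ⟦ map corner (∅ ∷ 𝐈 ∷ 𝐈 ∪ 𝐉 ∷ 𝐉 ∷ []) ⟧
  Rect-v-I-J = cong (λ y → ⟦ v ∷ neg I v ∷ y ∷ neg J v ∷ [] ⟧) (neg-∪ I∩J≡∅ v)

  Rect-v-I-K : Rect v I K ≡ ⟦ map corner (∅ ∷ 𝐈 ∷ 𝐈 ∪ 𝐊 ∷ 𝐊 ∷ []) ⟧
  Rect-v-I-K = cong (λ y → ⟦ v ∷ neg I v ∷ y ∷ neg K v ∷ [] ⟧) (neg-∪ I∩K≡∅ v)

  Rect-Jv-I-JK : Rect (neg J v) I (J ∪ K) ≡ ⟦ map corner (𝐉 ∷ 𝐈 ∪ 𝐉 ∷ 𝐈 ∪ 𝐊 ∷ 𝐊 ∷ []) ⟧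
  Rect-Jv-I-JK = cong₂ (λ y z → ⟦ neg J v ∷ neg I (neg J v) ∷ y ∷ z ∷ [] ⟧)
    (trans (neg-∪ I∩[J∪K]≡∅ (neg J v)) (cong (neg I) (neg-∪-cancelˡ J∩K≡∅ v)))
    (neg-∪-cancelˡ J∩K≡∅ v)

  Rect-v-IJ-K : Rect v (I ∪ J) K ≡ ⟦ map corner (∅ ∷ 𝐈 ∪ 𝐉 ∷ 𝐈 ∪ 𝐉 ∪ 𝐊 ∷ 𝐊 ∷ []) ⟧
  Rect-v-IJ-K = cong₂ (λ y z → ⟦ v ∷ y ∷ z ∷ neg K v ∷ [] ⟧)
    (neg-∪ I∩J≡∅ v) (trans (cong (λ P → neg P v) (∪-assoc I J K)) neg-IJK)

  Rect-v-I-JK : Rect v I (J ∪ K) ≡ ⟦ map corner (∅ ∷ 𝐈 ∷ 𝐈 ∪ 𝐉 ∪ 𝐊 ∷ 𝐉 ∪ 𝐊 ∷ []) ⟧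
  Rect-v-I-JK = cong₂ (λ y z → ⟦ v ∷ neg I v ∷ y ∷ z ∷ [] ⟧) neg-IJK (neg-∪ J∩K≡∅ v)

  Rect-Iv-J-IK : Rect (neg I v) J (I ∪ K) ≡ ⟦ map corner (𝐈 ∷ 𝐈 ∪ 𝐉 ∷ 𝐉 ∪ 𝐊 ∷ 𝐊 ∷ []) ⟧
  Rect-Iv-J-IK = cong (λ xs → ⟦ neg I v ∷ xs ⟧) (cong₂ _∷_ (neg-comm J I v) (cong₂ (λ y z → y ∷ z ∷ [])
    (trans (neg-∪ J∩[I∪K]≡∅ (neg I v))
           (cong (neg J) (neg-∪-cancelˡ I∩K≡∅ v)))
    (neg-∪-cancelˡ I∩K≡∅ v)))

  part₁ : UniqueCircuitIn ((Rect v I J ∪ᵥ Rect v I K) ∖ᵥ v) (Rect (neg J v) I (J ∪ K))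
  part₁ = subst-unique-circuit Rect-v-I-J Rect-v-I-K Rect-Jv-I-JK (unique-circuit
    (subst AffinelyDependent Rect-Jv-I-JK (rectangle-dependent I≢∅ (∪-nonemptyˡ J≢∅) I∩[J∪K]≡∅))
    (⊆-∪ᵥ-∖ᵥ (⊆.map⁺ corner (from-yes (xs₁ ⊆? as₁ ++ bs₁))) (∉-map⁺ corner-injective (from-no (∅ ∈? xs₁))))
    (dependent-subsets-contain (∪ᵥ-∖ᵥ-⊆ (⊆.map⁺ corner (from-yes (as₁ ++ bs₁ ⊆? ∅ ∷ 𝐈 ∷ xs₁))))
      (five-point-rigidity (from-yes (unique? (𝐈 ∷ xs₁)))
        (# 1 , true , refl) (# 2 , true , refl) (# 0 , false , refl) (# 1 , false , refl))))
    where
    as₁ = ∅ ∷ 𝐈 ∷ 𝐈 ∪ 𝐉 ∷ 𝐉 ∷ []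
    bs₁ = ∅ ∷ 𝐈 ∷ 𝐈 ∪ 𝐊 ∷ 𝐊 ∷ []
    xs₁ = 𝐉 ∷ 𝐈 ∪ 𝐉 ∷ 𝐈 ∪ 𝐊 ∷ 𝐊 ∷ []

  part₂ : UniqueCircuitIn ((Rect v (I ∪ J) K ∪ᵥ Rect v I (J ∪ K)) ∖ᵥ v) (Rect (neg I v) J (I ∪ K))
  part₂ = subst-unique-circuit Rect-v-IJ-K Rect-v-I-JK Rect-Iv-J-IK (unique-circuit
    (subst AffinelyDependent Rect-Iv-J-IK (rectangle-dependent J≢∅ (∪-nonemptyˡ I≢∅) J∩[I∪K]≡∅))
    (⊆-∪ᵥ-∖ᵥ (⊆.map⁺ corner (from-yes (xs₂ ⊆? as₂ ++ bs₂))) (∉-map⁺ corner-injective (from-no (∅ ∈? xs₂))))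
    (dependent-subsets-contain (∪ᵥ-∖ᵥ-⊆ (⊆.map⁺ corner (from-yes (as₂ ++ bs₂ ⊆? ∅ ∷ 𝐈 ∪ 𝐉 ∪ 𝐊 ∷ xs₂))))
      (five-point-rigidity (from-yes (unique? (𝐈 ∪ 𝐉 ∪ 𝐊 ∷ xs₂)))
        (# 2 , false , refl) (# 0 , false , refl) (# 1 , false , refl) (# 2 , true , refl))))
    where
    as₂ = ∅ ∷ 𝐈 ∪ 𝐉 ∷ 𝐈 ∪ 𝐉 ∪ 𝐊 ∷ 𝐊 ∷ []
    bs₂ = ∅ ∷ 𝐈 ∷ 𝐈 ∪ 𝐉 ∪ 𝐊 ∷ 𝐉 ∪ 𝐊 ∷ []
    xs₂ = 𝐈 ∷ 𝐈 ∪ 𝐉 ∷ 𝐉 ∪ 𝐊 ∷ 𝐊 ∷ []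

proposition2p2 : (n : ℕ) (v : Vertex n) (I J K : Subset n) →
    Nonempty I → Nonempty J → Nonempty K →
    Empty (I ∩ J) → Empty (I ∩ K) → Empty (J ∩ K) →
    UniqueCircuitIn ((Rect v I J ∪ᵥ Rect v I K) ∖ᵥ v) (Rect (neg J v) I (J ∪ K))
    × UniqueCircuitIn ((Rect v (I ∪ J) K ∪ᵥ Rect v I (J ∪ K)) ∖ᵥ v) (Rect (neg I v) J (I ∪ K))
proposition2p2 n v I J K (i , i∈I) (j , j∈J) (k , k∈K) I∩J≡∅ I∩K≡∅ J∩K≡∅ = part₁ , part₂
  where open ThreeBlocks v I J K I∩J≡∅ I∩K≡∅ J∩K≡∅ i j k i∈I j∈J k∈K
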